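{- Let $n\ge 1$ and let $\tau_1,\tau_2\in S_n$ each avoid both patterns $132$ and $123$. Then $\tau_1\circ\tau_2$ is $1$-almost-increasing, i.e. it avoids each of the patterns $4321, 4312, 3421, 3412$.
   Context: Permutations are viewed as bijections of $\{1,\dots,n\}$ written in one-line form $[\pi(1)\cdots\pi(n)]$, and $(\tau_1\circ\tau_2)(i)=\tau_1(\tau_2(i))$. A permutation contains a pattern $\sigma$ if some subsequence of its one-line form has the same relative order as $\sigma$; otherwise it avoids $\sigma$. -}

module Defs where

open import Data.Nat using (ℕ; _<_; suc)
open import Data.Fin using (Fin; toℕ)
open import Data.Fin.Permutation using (Permutation′; _⟨$⟩ʳ_; _∘ₚ_)
open import Data.Vec using (Vec; lookup; []; _∷_)
open import Data.Product using (Σ; _×_)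
open import Relation.Nullary using (¬_)
open import Function.Bundles using (_⇔_)

-- A permutation of {1,…,n}, represented on Fin n = {0,…,n-1}
-- (value i ∈ Fin n stands for i+1).
Perm : ℕ → Set
Perm n = Permutation′ n

app : ∀ {n} → Perm n → Fin n → Fin n
app π i = π ⟨$⟩ʳ i

-- composition (τ₁ ∘ τ₂)(i) = τ₁(τ₂(i))
compose : ∀ {n} → Perm n → Perm n → Perm n
compose τ₁ τ₂ = τ₂ ∘ₚ τ₁

Contains : ∀ {n k} → Perm n → Vec ℕ k → Set
Contains {n} {k} π σ =
  Σ (Fin k → Fin n) λ f →
    ((a b : Fin k) → toℕ a < toℕ b → toℕ (f a) < toℕ (f b)) ×
    ((a b : Fin k) → (toℕ (app π (f a)) < toℕ (app π (f b))) ⇔ (lookup σ a < lookup σ b))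

Avoids : ∀ {n k} → Perm n → Vec ℕ k → Set
Avoids π σ = ¬ Contains π σ

p132 p123 : Vec ℕ 3
p132 = 1 ∷ 3 ∷ 2 ∷ []
p123 = 1 ∷ 2 ∷ 3 ∷ []

p4321 p4312 p3421 p3412 : Vec ℕ 4
p4321 = 4 ∷ 3 ∷ 2 ∷ 1 ∷ []
p4312 = 4 ∷ 3 ∷ 1 ∷ 2 ∷ []
p3421 = 3 ∷ 4 ∷ 2 ∷ 1 ∷ []
p3412 = 3 ∷ 4 ∷ 1 ∷ 2 ∷ []

OneAlmostIncreasing : ∀ {n} → Perm n → Set
OneAlmostIncreasing π =
  Avoids π p4321 × Avoids π p4312 × Avoids π p3421 × Avoids π p3412

-- Avoiding both 123 and 132 says exactly that every entry has at most one
-- larger entry to its right. Suppose ρ = τ₁ ∘ τ₂ had positions i < j < k < l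
-- with ρ(k), ρ(l) both below ρ(i), ρ(j); say τ₂(i) < τ₂(j). Applied to τ₂ at
-- position i, the property puts τ₂(k) or τ₂(l) below τ₂(i), hence below τ₂(j)
-- too. Applied to τ₁ at that position, the two larger values τ₁τ₂(i) and
-- τ₁τ₂(j) to its right must coincide, which is absurd.
module Submission where

open import Defs
open import Data.Nat as ℕ using (ℕ; _≥_; z≤n; s≤s)
open import Data.Fin using (Fin; _<_)
open import Data.Fin.Patterns using (0F; 1F; 2F; 3F)
open import Data.Fin.Properties using (<-cmp; <-trans; <-asym; <-irrefl; <⇒≢; all?; _≟_)
open import Data.Vec using (Vec; lookup; []; _∷_)
open import Data.Product using (_,_)
open import Data.Sum using (_⊎_; inj₁; inj₂)
open import Data.Empty using (⊥; ⊥-elim)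
open import Function.Base using (case_of_)
open import Function.Bundles using (Injection; mk⇔; Equivalence)
open import Function.Properties.Inverse using (↔⇒↣)
open import Relation.Binary using (tri<; tri≈; tri>)
open import Relation.Binary.PropositionalEquality using (_≡_; _≢_; refl)
open import Relation.Nullary using (Dec)
open import Relation.Nullary.Decidable using (_→-dec_; from-yes)
import Data.Nat.Properties as ℕ

private
  variable
    k n : ℕ

app-injective : (π : Perm n) {p q : Fin n} → app π p ≡ app π q → p ≡ q
app-injective π = Injection.injective (↔⇒↣ π)

AtMostOneLargerAfter : Perm n → Set
AtMostOneLargerAfter {n} π = ∀ {p q r : Fin n} → p < q → p < r →
  app π p < app π q → app π p < app π r → q ≡ r

LookupInjective : Vec ℕ k → Set
LookupInjective {k} σ = (a b : Fin k) → lookup σ a ≡ lookup σ b → a ≡ b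

lookup-injective? : (σ : Vec ℕ k) → Dec (LookupInjective σ)
lookup-injective? σ = all? λ a → all? λ b → (lookup σ a ℕ.≟ lookup σ b) →-dec (a ≟ b)

contains-byOrderPreserving : (π : Perm n) (σ : Vec ℕ k) → LookupInjective σ →
  (f : Fin k → Fin n) → (∀ a b → a < b → f a < f b) →
  (∀ a b → lookup σ a ℕ.< lookup σ b → app π (f a) < app π (f b)) →
  Contains π σ
contains-byOrderPreserving π σ σ-inj f f-mono f-pres = f , f-mono , λ a b → mk⇔ (reflect a b) (f-pres a b)
  where
  reflect : ∀ a b → app π (f a) < app π (f b) → lookup σ a ℕ.< lookup σ b
  reflect a b πa<πb with ℕ.<-cmp (lookup σ a) (lookup σ b)
  ... | tri< σa<σb _ _ = σa<σb
  ... | tri≈ _ σa≡σb _ with refl ← σ-inj a b σa≡σb = ⊥-elim (<-irrefl refl πa<πb)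
  ... | tri> _ _ σb<σa = ⊥-elim (<-asym πa<πb (f-pres b a σb<σa))

triple-increasing : {p q r : Fin n} → p < q → q < r →
  ∀ a b → a < b → lookup (p ∷ q ∷ r ∷ []) a < lookup (p ∷ q ∷ r ∷ []) b
triple-increasing p<q q<r 0F 1F _ = p<q
triple-increasing p<q q<r 0F 2F _ = <-trans p<q q<r
triple-increasing p<q q<r 1F 2F _ = q<r
triple-increasing _ _ 0F 0F ()
triple-increasing _ _ 1F 0F ()
triple-increasing _ _ 1F 1F (s≤s ())
triple-increasing _ _ 2F 0F ()
triple-increasing _ _ 2F 1F (s≤s ())
triple-increasing _ _ 2F 2F (s≤s (s≤s ()))

module _ (π : Perm n) {p q r : Fin n} (p<q : p < q) (q<r : q < r) where

  private
    πf : Fin 3 → Fin n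
    πf a = app π (lookup (p ∷ q ∷ r ∷ []) a)

  contains-123 : πf 0F < πf 1F → πf 1F < πf 2F → Contains π p123
  contains-123 x<y y<z = contains-byOrderPreserving π p123 (from-yes (lookup-injective? p123))
    _ (triple-increasing p<q q<r) preserves
    where
    preserves : ∀ a b → lookup p123 a ℕ.< lookup p123 b → πf a < πf b
    preserves 0F 1F _ = x<y
    preserves 0F 2F _ = <-trans x<y y<z
    preserves 1F 2F _ = y<z
    preserves 0F 0F (s≤s ())
    preserves 1F 0F (s≤s ())
    preserves 1F 1F (s≤s (s≤s ()))
    preserves 2F 0F (s≤s ())
    preserves 2F 1F (s≤s (s≤s ()))
    preserves 2F 2F (s≤s (s≤s (s≤s ())))

  contains-132 : πf 0F < πf 2F → πf 2F < πf 1F → Contains π p132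
  contains-132 x<z z<y = contains-byOrderPreserving π p132 (from-yes (lookup-injective? p132))
    _ (triple-increasing p<q q<r) preserves
    where
    preserves : ∀ a b → lookup p132 a ℕ.< lookup p132 b → πf a < πf b
    preserves 0F 1F _ = <-trans x<z z<y
    preserves 0F 2F _ = x<z
    preserves 2F 1F _ = z<y
    preserves 0F 0F (s≤s ())
    preserves 1F 0F (s≤s ())
    preserves 1F 1F (s≤s (s≤s (s≤s ())))
    preserves 1F 2F (s≤s (s≤s ()))
    preserves 2F 0F (s≤s ())
    preserves 2F 2F (s≤s (s≤s ()))

noTwoLargerAfter : (π : Perm n) → Avoids π p132 → Avoids π p123 → {p q r : Fin n} →
  p < q → q < r → app π p < app π q → app π p < app π r → ⊥
noTwoLargerAfter π ¬132 ¬123 {p} {q} {r} p<q q<r πp<πq πp<πr with <-cmp (app π q) (app π r)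
... | tri< πq<πr _ _ = ¬123 (contains-123 π p<q q<r πp<πq πq<πr)
... | tri≈ _ πq≡πr _ = <⇒≢ q<r (app-injective π πq≡πr)
... | tri> _ _ πr<πq = ¬132 (contains-132 π p<q q<r πp<πr πr<πq)

avoids-132-123⇒atMostOneLargerAfter : (π : Perm n) → Avoids π p132 → Avoids π p123 →
  AtMostOneLargerAfter π
avoids-132-123⇒atMostOneLargerAfter π ¬132 ¬123 {p} {q} {r} p<q p<r πp<πq πp<πr with <-cmp q r
... | tri< q<r _ _ = ⊥-elim (noTwoLargerAfter π ¬132 ¬123 p<q q<r πp<πq πp<πr)
... | tri≈ _ q≡r _ = q≡r
... | tri> _ _ r<q = ⊥-elim (noTwoLargerAfter π ¬132 ¬123 p<r r<q πp<πr πp<πq)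

oneOfTwoAfterBelow : (π : Perm n) → AtMostOneLargerAfter π → {p q r : Fin n} →
  p < q → p < r → q ≢ r → app π q < app π p ⊎ app π r < app π p
oneOfTwoAfterBelow π atMostOne {p} {q} {r} p<q p<r q≢r
  with <-cmp (app π p) (app π q) | <-cmp (app π p) (app π r)
... | tri> _ _ πq<πp | _                = inj₁ πq<πp
... | _              | tri> _ _ πr<πp = inj₂ πr<πp
... | tri≈ _ πp≡πq _ | _                = ⊥-elim (<⇒≢ p<q (app-injective π πp≡πq))
... | _              | tri≈ _ πp≡πr _ = ⊥-elim (<⇒≢ p<r (app-injective π πp≡πr))
... | tri< πp<πq _ _ | tri< πp<πr _ _ = ⊥-elim (q≢r (atMostOne p<q p<r πp<πq πp<πr))

-- The configurations excluded here are exactly the occurrences of 4321, 4312,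
-- 3421 and 3412.
NoLowLatePair : Perm n → Set
NoLowLatePair {n} ρ = ∀ {i j k l : Fin n} → i < j → j < k → k < l →
  app ρ k < app ρ i → app ρ k < app ρ j → app ρ l < app ρ i → app ρ l < app ρ j → ⊥

compose-noLowLatePair : (τ₁ τ₂ : Perm n) → AtMostOneLargerAfter τ₁ → AtMostOneLargerAfter τ₂ →
  NoLowLatePair (compose τ₁ τ₂)
compose-noLowLatePair τ₁ τ₂ h₁ h₂ {i} {j} {k} {l} i<j j<k k<l ki kj li lj =
  case <-cmp (app τ₂ i) (app τ₂ j) of λ where
    (tri< a<b _ _) → ordered (<-trans i<j j<k) a<b ki kj li lj
    (tri≈ _ a≡b _) → <⇒≢ i<j (app-injective τ₂ a≡b)
    (tri> _ _ b<a) → ordered j<k b<a kj ki lj li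
  where
  ρ : Fin _ → Fin _
  ρ = app (compose τ₁ τ₂)
  ordered : ∀ {x y} → x < k → app τ₂ x < app τ₂ y →
    ρ k < ρ x → ρ k < ρ y → ρ l < ρ x → ρ l < ρ y → ⊥
  ordered x<k a<b kx ky lx ly with oneOfTwoAfterBelow τ₂ h₂ x<k (<-trans x<k k<l) (<⇒≢ k<l)
  ... | inj₁ c<a = <⇒≢ a<b (h₁ c<a (<-trans c<a a<b) kx ky)
  ... | inj₂ d<a = <⇒≢ a<b (h₁ d<a (<-trans d<a a<b) lx ly)

noLowLatePair⇒avoids : (ρ : Perm n) → NoLowLatePair ρ → (σ : Vec ℕ 4) →
  lookup σ 2F ℕ.< lookup σ 0F → lookup σ 2F ℕ.< lookup σ 1F →
  lookup σ 3F ℕ.< lookup σ 0F → lookup σ 3F ℕ.< lookup σ 1F →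
  Avoids ρ σ
noLowLatePair⇒avoids ρ noPair σ σ₂<σ₀ σ₂<σ₁ σ₃<σ₀ σ₃<σ₁ (f , f-mono , sameOrder) =
  noPair (f-mono 0F 1F (s≤s z≤n)) (f-mono 1F 2F (s≤s (s≤s z≤n))) (f-mono 2F 3F (s≤s (s≤s (s≤s z≤n))))
    (reflect 2F 0F σ₂<σ₀) (reflect 2F 1F σ₂<σ₁) (reflect 3F 0F σ₃<σ₀) (reflect 3F 1F σ₃<σ₁)
  where
  reflect : ∀ a b → lookup σ a ℕ.< lookup σ b → app ρ (f a) < app ρ (f b)
  reflect a b = Equivalence.from (sameOrder a b)

mainTheorem11 : (n : ℕ) → n ≥ 1 → (τ₁ τ₂ : Perm n) →
    Avoids τ₁ p132 → Avoids τ₁ p123 →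
    Avoids τ₂ p132 → Avoids τ₂ p123 →
    OneAlmostIncreasing (compose τ₁ τ₂)
mainTheorem11 n _ τ₁ τ₂ ¬132₁ ¬123₁ ¬132₂ ¬123₂ =
  noLowLatePair⇒avoids ρ noPair p4321 2<4 2<3 1<4 1<3 ,
  noLowLatePair⇒avoids ρ noPair p4312 1<4 1<3 2<4 2<3 ,
  noLowLatePair⇒avoids ρ noPair p3421 2<3 2<4 1<3 1<4 ,
  noLowLatePair⇒avoids ρ noPair p3412 1<3 1<4 2<3 2<4
  where
  ρ : Perm n
  ρ = compose τ₁ τ₂
  noPair : NoLowLatePair ρ
  noPair = compose-noLowLatePair τ₁ τ₂
    (avoids-132-123⇒atMostOneLargerAfter τ₁ ¬132₁ ¬123₁)
    (avoids-132-123⇒atMostOneLargerAfter τ₂ ¬132₂ ¬123₂)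
  1<3 : 1 ℕ.< 3
  1<3 = s≤s (s≤s z≤n)
  1<4 : 1 ℕ.< 4
  1<4 = s≤s (s≤s z≤n)
  2<3 : 2 ℕ.< 3
  2<3 = s≤s (s≤s (s≤s z≤n))
  2<4 : 2 ℕ.< 4
  2<4 = s≤s (s≤s (s≤s z≤n))
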